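{- There is a dense subset $D\subseteq(0,1)$ such that for every $\epsilon\in D$ the following holds: there exist a strictly increasing sequence of positive integers $d_1<d_2<\cdots$, set systems $\mathcal A_i,\mathcal B_i\subseteq 2^{[d_i]}$, numbers $\delta_i$ with $\delta_i\to\epsilon$ as $i\to\infty$, and a constant $c_\epsilon>0$, such that for every $i$, $(\mathcal A_i,\mathcal B_i)$ is $\delta_i$-almost cross-disjoint, and every $0$-monochromatic submatrix of $\mathsf{Mat}(\mathcal A_i,\mathcal B_i)$ has density at most $2^{ -c_\epsilon\sqrt{d_i}}$.
   Context: $[d]=\{1,\dots,d\}$ and $2^{[d]}$ is its power set. For $\mathcal A,\mathcal B\subseteq 2^{[d]}$ and $\delta\in[0,1]$, $(\mathcal A,\mathcal B)$ is $\delta$-almost cross-disjoint if $\Pr_{A\sim\mathcal A,B\sim\mathcal B}[A\cap B\ne\emptyset]\le\delta$, where $A,B$ are uniform and independent. $\mathsf{Mat}(\mathcal A,\mathcal B)$ is the matrix with rows indexed by $\mathcal A$, columns by $\mathcal B$, and $(A,B)$-entry $|A\cap B|$. A $0$-monochromatic submatrix is given by $\mathcal R\subseteq\mathcal A$, $\mathcal S\subseteq\mathcal B$ such that $|R\cap S|=0$ for all $R\in\mathcal R$, $S\in\mathcal S$; its density is $|\mathcal R||\mathcal S|/(|\mathcal A||\mathcal B|)$. -}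

module Defs where

open import Data.Nat using (ℕ; zero; suc; _+_; _*_; _^_; _≤_; _<_; NonZero; _≡ᵇ_)
open import Data.Bool using (if_then_else_)
open import Data.Fin using (Fin)
open import Data.Fin.Subset using (Subset; _∩_; ∣_∣; _∈_)
open import Data.List using (map; allFin)
open import Data.Nat.ListAction using (sum)
open import Data.Integer using (+_)
open import Data.Rational as ℚ using (ℚ; _/_)
open import Relation.Binary.PropositionalEquality using (_≡_)
open import Function.Definitions using (Injective)

record SetSystem (d : ℕ) : Set where
  constructor setSystem
  field
    size     : ℕ
    nonempty : 0 < size
    sets     : Fin size → Subset d
    distinct : Injective _≡_ _≡_ sets
open SetSystem public

Mat : ∀ {d} (𝒜 ℬ : SetSystem d) → Fin (size 𝒜) → Fin (size ℬ) → ℕ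
Mat 𝒜 ℬ i j = ∣ sets 𝒜 i ∩ sets ℬ j ∣

intersectingPairs : ∀ {d} (𝒜 ℬ : SetSystem d) → ℕ
intersectingPairs 𝒜 ℬ =
  sum (map (λ i → sum (map (λ j → if Mat 𝒜 ℬ i j ≡ᵇ 0 then 0 else 1)
                               (allFin (size ℬ))))
           (allFin (size 𝒜)))

nonZero* : ∀ {m n} → 0 < m → 0 < n → NonZero (m * n)
nonZero* {suc m} {suc n} _ _ = _

Pr-intersect : ∀ {d} (𝒜 ℬ : SetSystem d) → ℚ
Pr-intersect 𝒜 ℬ =
  _/_ (+ intersectingPairs 𝒜 ℬ) (size 𝒜 * size ℬ)
      {{nonZero* (nonempty 𝒜) (nonempty ℬ)}}

AlmostCrossDisjoint : ∀ {d} → ℚ → SetSystem d → SetSystem d → Set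
AlmostCrossDisjoint δ 𝒜 ℬ = Pr-intersect 𝒜 ℬ ℚ.≤ δ

ZeroMonochromatic : ∀ {d} (𝒜 ℬ : SetSystem d) →
                    Subset (size 𝒜) → Subset (size ℬ) → Set
ZeroMonochromatic 𝒜 ℬ ℛ 𝒮 =
  ∀ i j → i ∈ ℛ → j ∈ 𝒮 → Mat 𝒜 ℬ i j ≡ 0

-- "r / N ≤ 2^(-(a/b)·√d)" for a rational constant c = a/b > 0, written
-- without reals: for every rational x = p/q ≥ 0 with x < c·√d
-- (i.e. p²b² < a²dq²) we have 2^x · (r/N) ≤ 1, i.e. 2^p · r^q ≤ N^q.
-- (By continuity of 2^x this is exactly r/N ≤ 2^(-c√d).)
DensityAtMostExp : (r N a b d : ℕ) → Set
DensityAtMostExp r N a b d =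
  ∀ p q → 0 < q → p * p * (b * b) < a * a * d * (q * q) →
  2 ^ p * r ^ q ≤ N ^ q

{-# OPTIONS --safe #-}
-- Fix a rational δ ∈ (a, b), let t be its denominator, and for k ≥ 1 encode each word
-- w ∈ [m]^k, m = t k, as its graph {(j, w j)} ⊆ [k] × [m] ≅ [d], d = k m = t k².  Taking
-- 𝒜 = ℬ = all graphs, |A_w ∩ A_v| counts the coordinates where w and v agree, whose
-- average is k/m = 1/t ≤ δ; this bounds the probability that A ∩ B ≠ ∅, so δ_i = δ works.
-- A 0-monochromatic rectangle (ℛ, 𝒮) consists of words disagreeing in every coordinate.
-- Split both sides by the first letter: no letter occurs on both sides, so at most m²/4
-- of the m² pairs of first letters carry any mass (AM–GM), and each pair is again a
-- 0-monochromatic rectangle one coordinate shorter.  Hence the density is at most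
-- 4^{-k} ≤ 2^{-c√d} with c = 1/t, as √d = k√t.
module Submission where

open import Defs
open import Data.Bool using (Bool; true; false; if_then_else_)
open import Data.Empty using (⊥-elim)
open import Data.Fin using (Fin; zero; suc; _↑ˡ_; _↑ʳ_; combine; quotient; remainder)
open import Data.Fin.Properties using (remQuot-combine; combine-remQuot)
open import Data.Fin.Subset using (Subset; ⊥; _∩_; ∣_∣; _∈_; ⁅_⁆; Nonempty; Empty)
open import Data.Fin.Subset.Properties
  using (∩-zeroʳ; ∩-idem; ∣⊥∣≡0; ∣p∣≤n; Empty-unique; nonempty?; ∣⁅x⁆∣≡1; x∈⁅x⁆; x∈⁅y⁆⇒x≡y)
import Data.Integer as ℤ
import Data.Integer.Properties as ℤP
open import Data.List using (map; allFin; tabulate)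
open import Data.List.Properties using (map-tabulate)
open import Data.Nat
  using (ℕ; zero; suc; _+_; _*_; _^_; _≤_; _<_; z≤n; s≤s; NonZero; _≡ᵇ_; _≤?_; >-nonZero⁻¹)
import Data.Nat.ListAction as List
open import Data.Nat.Properties
open import Data.Nat.Solver using (module +-*-Solver)
open +-*-Solver using (solve; _:+_; _:*_; con; _:=_)
open import Data.Product using (Σ; _×_; _,_; proj₁; proj₂)
open import Data.Rational as ℚ using (ℚ; 0ℚ; 1ℚ; _-_)
import Data.Rational.Properties as ℚP
import Data.Rational.Unnormalised as ℚᵘ
import Data.Rational.Unnormalised.Properties as ℚᵘP
open import Data.Vec using ([]; _∷_; _++_; lookup)
import Data.Vec as Vec
open import Data.Vec.Properties
  using (zipWith-++; ++-injectiveˡ; ++-injectiveʳ; lookup∘tabulate; lookup⇒[]=; []=⇒lookup)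
open import Function using (_∘_; id)
open import Function.Definitions using (Injective)
open import Relation.Binary.PropositionalEquality
open import Relation.Nullary using (¬_; yes; no; contradiction)

open import Algebra.Properties.Semiring.Sum +-*-semiring
  using (sum; sum-syntax; sum-cong-≗; ∑-distrib-+; *-distribˡ-sum; *-distribʳ-sum)

∑-const : ∀ n c → ∑[ i < n ] c ≡ n * c
∑-const zero    c = refl
∑-const (suc n) c = cong (c +_) (∑-const n c)

∑-mono-≤ : ∀ {n} {f g : Fin n → ℕ} → (∀ i → f i ≤ g i) → sum f ≤ sum g
∑-mono-≤ {zero}  f≤g = z≤n
∑-mono-≤ {suc n} f≤g = +-mono-≤ (f≤g zero) (∑-mono-≤ (f≤g ∘ suc))

∑-++ : ∀ m n (f : Fin (m + n) → ℕ) →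
       sum f ≡ ∑[ i < m ] f (i ↑ˡ n) + ∑[ j < n ] f (m ↑ʳ j)
∑-++ zero    n f = refl
∑-++ (suc m) n f = trans (cong (f zero +_) (∑-++ m n (f ∘ suc))) (sym (+-assoc (f zero) _ _))

∑-combine : ∀ m n (f : Fin (m * n) → ℕ) →
            sum f ≡ ∑[ x < m ] ∑[ y < n ] f (combine x y)
∑-combine zero    n f = refl
∑-combine (suc m) n f =
  trans (∑-++ n (m * n) f) (cong (sum (λ y → f (y ↑ˡ m * n)) +_) (∑-combine m n (f ∘ (n ↑ʳ_))))

∑-*-∑ : ∀ {m n} c (f : Fin m → ℕ) (g : Fin n → ℕ) →
        c * (sum f * sum g) ≡ ∑[ x < m ] ∑[ y < n ] (c * (f x * g y))
∑-*-∑ {m} {n} c f g = begin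
  c * (sum f * sum g)                      ≡⟨ *-assoc c (sum f) (sum g) ⟨
  c * sum f * sum g                        ≡⟨ cong (_* sum g) (*-distribˡ-sum c f) ⟩
  (∑[ x < m ] (c * f x)) * sum g           ≡⟨ *-distribʳ-sum (sum g) (λ x → c * f x) ⟩
  ∑[ x < m ] (c * f x * sum g)             ≡⟨ sum-cong-≗ (λ x → *-assoc c (f x) (sum g)) ⟩
  ∑[ x < m ] (c * (f x * sum g))           ≡⟨ sum-cong-≗ (λ x → cong (c *_) (*-distribˡ-sum (f x) g)) ⟩
  ∑[ x < m ] (c * ∑[ y < n ] (f x * g y))  ≡⟨ sum-cong-≗ (λ x → *-distribˡ-sum c (λ y → f x * g y)) ⟩
  ∑[ x < m ] ∑[ y < n ] (c * (f x * g y))  ∎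
  where open ≡-Reasoning

sum-tabulate : ∀ {n} (f : Fin n → ℕ) → List.sum (tabulate f) ≡ sum f
sum-tabulate {zero}  f = refl
sum-tabulate {suc n} f = cong (f zero +_) (sum-tabulate (f ∘ suc))

sum-map-allFin : ∀ n (f : Fin n → ℕ) → List.sum (map f (allFin n)) ≡ sum f
sum-map-allFin n f = trans (cong List.sum (map-tabulate id f)) (sum-tabulate f)

signum : ℕ → ℕ
signum zero    = 0
signum (suc _) = 1

4*m*n≤[m+n]² : ∀ m n → 4 * (m * n) ≤ (m + n) * (m + n)
4*m*n≤[m+n]² zero    n       = z≤n
4*m*n≤[m+n]² (suc m) zero    = ≤-trans (≤-reflexive (cong (4 *_) (*-zeroʳ (suc m)))) z≤n
4*m*n≤[m+n]² (suc m) (suc n) = begin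
  4 * (suc m * suc n)
    ≡⟨ solve 2 (λ m n → con 4 :* ((con 1 :+ m) :* (con 1 :+ n)) := con 4 :* (m :* n) :+ (con 4 :* (m :+ n) :+ con 4)) refl m n ⟩
  4 * (m * n) + (4 * (m + n) + 4)
    ≤⟨ +-monoˡ-≤ (4 * (m + n) + 4) (4*m*n≤[m+n]² m n) ⟩
  (m + n) * (m + n) + (4 * (m + n) + 4)
    ≡⟨ solve 2 (λ m n → (m :+ n) :* (m :+ n) :+ (con 4 :* (m :+ n) :+ con 4) := (con 1 :+ m :+ (con 1 :+ n)) :* (con 1 :+ m :+ (con 1 :+ n))) refl m n ⟩
  (suc m + suc n) * (suc m + suc n) ∎
  where open ≤-Reasoning

*≤⇒*≤*signum : ∀ c u v N → c * (u * v) ≤ N → c * (u * v) ≤ N * (signum u * signum v)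
*≤⇒*≤*signum c zero    v       N _ = ≤-trans (≤-reflexive (*-zeroʳ c)) z≤n
*≤⇒*≤*signum c (suc u) zero    N _ = ≤-trans (≤-reflexive (trans (cong (c *_) (*-zeroʳ (suc u))) (*-zeroʳ c))) z≤n
*≤⇒*≤*signum c (suc u) (suc v) N h = ≤-trans h (≤-reflexive (sym (*-identityʳ _)))

signum+signum≤1 : ∀ u v → ¬ (u ≢ 0 × v ≢ 0) → signum u + signum v ≤ 1
signum+signum≤1 zero    zero    _ = z≤n
signum+signum≤1 zero    (suc v) _ = ≤-refl
signum+signum≤1 (suc u) zero    _ = ≤-refl
signum+signum≤1 (suc u) (suc v) h = ⊥-elim (h ((λ ()) , (λ ())))

indicator : Bool → ℕ
indicator true  = 1
indicator false = 0

∣p∣≡∑indicator : ∀ {n} (p : Subset n) → ∣ p ∣ ≡ ∑[ i < n ] indicator (lookup p i)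
∣p∣≡∑indicator []          = refl
∣p∣≡∑indicator (true ∷ p)  = cong suc (∣p∣≡∑indicator p)
∣p∣≡∑indicator (false ∷ p) = ∣p∣≡∑indicator p

∣p++q∣ : ∀ {m n} (p : Subset m) (q : Subset n) → ∣ p ++ q ∣ ≡ ∣ p ∣ + ∣ q ∣
∣p++q∣ []          q = refl
∣p++q∣ (true ∷ p)  q = cong suc (∣p++q∣ p q)
∣p++q∣ (false ∷ p) q = ∣p++q∣ p q

∣++∩++∣ : ∀ {m n} (p p′ : Subset m) (q q′ : Subset n) →
          ∣ (p ++ q) ∩ (p′ ++ q′) ∣ ≡ ∣ p ∩ p′ ∣ + ∣ q ∩ q′ ∣
∣++∩++∣ p p′ q q′ = trans (cong ∣_∣ (zipWith-++ _ p q p′ q′)) (∣p++q∣ (p ∩ p′) (q ∩ q′))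

∣p∣≢0⇒Nonempty : ∀ {n} (p : Subset n) → ∣ p ∣ ≢ 0 → Nonempty p
∣p∣≢0⇒Nonempty {n} p ∣p∣≢0 with nonempty? p
... | yes p≢∅ = p≢∅
... | no  p≡∅ = contradiction (trans (cong ∣_∣ (Empty-unique p≡∅)) (∣⊥∣≡0 n)) ∣p∣≢0

∣p∩⊥∣≡0 : ∀ {n} (p : Subset n) → ∣ p ∩ ⊥ ∣ ≡ 0
∣p∩⊥∣≡0 {n} p = trans (cong ∣_∣ (∩-zeroʳ p)) (∣⊥∣≡0 n)

∑∣p∩⁅i⁆∣≡∣p∣ : ∀ {n} (p : Subset n) → ∑[ i < n ] ∣ p ∩ ⁅ i ⁆ ∣ ≡ ∣ p ∣
∑∣p∩⁅i⁆∣≡∣p∣ []          = refl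
∑∣p∩⁅i⁆∣≡∣p∣ (true ∷ p)  = cong₂ (λ a b → suc (a + b)) (∣p∩⊥∣≡0 p) (∑∣p∩⁅i⁆∣≡∣p∣ p)
∑∣p∩⁅i⁆∣≡∣p∣ (false ∷ p) = cong₂ _+_ (∣p∩⊥∣≡0 p) (∑∣p∩⁅i⁆∣≡∣p∣ p)

infixr 6 _⊗_

_⊗_ : ∀ {p q a b} → (Fin p → Subset a) → (Fin q → Subset b) → Fin (p * q) → Subset (a + b)
(_⊗_ {p} {q} F G) i = F (quotient {p} q i) ++ G (remainder {p} q i)

quotient-combine : ∀ {p q} (x : Fin p) (y : Fin q) → quotient {p} q (combine x y) ≡ x
quotient-combine x y = cong proj₁ (remQuot-combine x y)

remainder-combine : ∀ {p q} (x : Fin p) (y : Fin q) → remainder {p} q (combine x y) ≡ y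
remainder-combine x y = cong proj₂ (remQuot-combine x y)

∑-separable : ∀ p q (f : Fin p → ℕ) (g : Fin q → ℕ) →
              ∑[ i < p * q ] (f (quotient {p} q i) + g (remainder {p} q i)) ≡ q * sum f + p * sum g
∑-separable p q f g = begin
  ∑[ i < p * q ] (f (quot i) + g (rem i))
    ≡⟨ ∑-combine p q _ ⟩
  ∑[ x < p ] ∑[ y < q ] (f (quot (combine x y)) + g (rem (combine x y)))
    ≡⟨ sum-cong-≗ (λ x → sum-cong-≗ (λ y → cong₂ _+_ (cong f (quotient-combine x y)) (cong g (remainder-combine x y)))) ⟩
  ∑[ x < p ] ∑[ y < q ] (f x + g y)
    ≡⟨ sum-cong-≗ (λ x → trans (∑-distrib-+ (λ _ → f x) g) (cong (_+ sum g) (∑-const q (f x)))) ⟩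
  ∑[ x < p ] (q * f x + sum g)
    ≡⟨ ∑-distrib-+ (λ x → q * f x) (λ _ → sum g) ⟩
  ∑[ x < p ] (q * f x) + ∑[ x < p ] sum g
    ≡⟨ cong₂ _+_ (sym (*-distribˡ-sum q f)) (∑-const p (sum g)) ⟩
  q * sum f + p * sum g ∎
  where
  open ≡-Reasoning
  quot : Fin (p * q) → Fin p
  quot = quotient {p} q
  rem : Fin (p * q) → Fin q
  rem = remainder {p} q

⊗-combine : ∀ {p q a b} (F : Fin p → Subset a) (G : Fin q → Subset b) x y →
            (F ⊗ G) (combine x y) ≡ F x ++ G y
⊗-combine F G x y = cong₂ (λ x′ y′ → F x′ ++ G y′) (quotient-combine x y) (remainder-combine x y)

∣⊗∩⊗∣ : ∀ {p q a b} (F : Fin p → Subset a) (G : Fin q → Subset b) x y x′ y′ →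
        ∣ (F ⊗ G) (combine x y) ∩ (F ⊗ G) (combine x′ y′) ∣ ≡ ∣ F x ∩ F x′ ∣ + ∣ G y ∩ G y′ ∣
∣⊗∩⊗∣ F G x y x′ y′ = trans (cong₂ (λ u v → ∣ u ∩ v ∣) (⊗-combine F G x y) (⊗-combine F G x′ y′))
                            (∣++∩++∣ (F x) (F x′) (G y) (G y′))

⊗-injective : ∀ {p q a b} {F : Fin p → Subset a} {G : Fin q → Subset b} →
              Injective _≡_ _≡_ F → Injective _≡_ _≡_ G → Injective _≡_ _≡_ (F ⊗ G)
⊗-injective {p} {q} {F = F} F-inj G-inj {i} {j} Fi++Gi≡Fj++Gj = begin
  i                              ≡⟨ combine-remQuot {p} q i ⟨
  combine (quot i) (rem i)       ≡⟨ cong₂ combine (F-inj (++-injectiveˡ _ _ Fi++Gi≡Fj++Gj))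
                                                  (G-inj (++-injectiveʳ (F (quot i)) _ Fi++Gi≡Fj++Gj)) ⟩
  combine (quot j) (rem j)       ≡⟨ combine-remQuot {p} q j ⟩
  j                              ∎
  where
  open ≡-Reasoning
  quot : Fin (p * q) → Fin p
  quot = quotient {p} q
  rem : Fin (p * q) → Fin q
  rem = remainder {p} q

⁅⁆-injective : ∀ {n} → Injective _≡_ _≡_ (⁅_⁆ {n})
⁅⁆-injective {x = x} {y} eq = x∈⁅y⁆⇒x≡y y (subst (x ∈_) eq (x∈⁅x⁆ x))

-- power m k w is the graph of the word w ∈ [m]^k: k consecutive blocks of m bits, the
-- j-th block being the singleton of the j-th letter.
power : ∀ m k → Fin (m ^ k) → Subset (k * m)
power m zero    _ = []
power m (suc k)   = ⁅_⁆ ⊗ power m k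

power-injective : ∀ m k → Injective _≡_ _≡_ (power m k)
power-injective m zero    {zero} {zero} _ = refl
power-injective m (suc k) = ⊗-injective ⁅⁆-injective (power-injective m k)

totalOverlap : ∀ {n d} → (Fin n → Subset d) → ℕ
totalOverlap {n} F = ∑[ i < n ] ∑[ j < n ] ∣ F i ∩ F j ∣

totalOverlap-⊗ : ∀ {p q a b} (F : Fin p → Subset a) (G : Fin q → Subset b) →
                 totalOverlap (F ⊗ G) ≡ q * (q * totalOverlap F) + p * (p * totalOverlap G)
totalOverlap-⊗ {p} {q} F G = begin
  totalOverlap (F ⊗ G)
    ≡⟨ sum-cong-≗ (λ i → trans (sum-cong-≗ (λ j → ∣++∩++∣ (F (quot i)) (F (quot j)) (G (rem i)) (G (rem j))))
                                (∑-separable p q (rowF (quot i)) (rowG (rem i)))) ⟩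
  ∑[ i < p * q ] (q * sum (rowF (quot i)) + p * sum (rowG (rem i)))
    ≡⟨ ∑-separable p q (λ x → q * sum (rowF x)) (λ y → p * sum (rowG y)) ⟩
  q * ∑[ x < p ] (q * sum (rowF x)) + p * ∑[ y < q ] (p * sum (rowG y))
    ≡⟨ cong₂ (λ s t → q * s + p * t) (sym (*-distribˡ-sum q (sum ∘ rowF))) (sym (*-distribˡ-sum p (sum ∘ rowG))) ⟩
  q * (q * totalOverlap F) + p * (p * totalOverlap G) ∎
  where
  open ≡-Reasoning
  quot : Fin (p * q) → Fin p
  quot = quotient {p} q
  rem : Fin (p * q) → Fin q
  rem = remainder {p} q
  rowF : Fin p → Fin p → ℕ
  rowF x x′ = ∣ F x ∩ F x′ ∣
  rowG : Fin q → Fin q → ℕ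
  rowG y y′ = ∣ G y ∩ G y′ ∣

totalOverlap-⁅⁆ : ∀ m → totalOverlap (⁅_⁆ {m}) ≡ m
totalOverlap-⁅⁆ m = begin
  ∑[ x < m ] ∑[ y < m ] ∣ ⁅ x ⁆ ∩ ⁅ y ⁆ ∣   ≡⟨ sum-cong-≗ {m} (λ x → trans (∑∣p∩⁅i⁆∣≡∣p∣ ⁅ x ⁆) (∣⁅x⁆∣≡1 x)) ⟩
  ∑[ x < m ] 1                               ≡⟨ ∑-const m 1 ⟩
  m * 1                                      ≡⟨ *-identityʳ m ⟩
  m                                          ∎
  where open ≡-Reasoning

totalOverlap-power : ∀ m k → totalOverlap (power m k) * m ≡ k * (m ^ k * m ^ k)
totalOverlap-power m zero    = refl
totalOverlap-power m (suc k) = begin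
  totalOverlap (power m (suc k)) * m
    ≡⟨ cong (_* m) (totalOverlap-⊗ (⁅_⁆ {m}) (power m k)) ⟩
  (M * (M * totalOverlap (⁅_⁆ {m})) + m * (m * T)) * m
    ≡⟨ cong (λ s → (M * (M * s) + m * (m * T)) * m) (totalOverlap-⁅⁆ m) ⟩
  (M * (M * m) + m * (m * T)) * m
    ≡⟨ solve 3 (λ m M T → (M :* (M :* m) :+ m :* (m :* T)) :* m := (m :* M) :* (m :* M) :+ m :* m :* (T :* m)) refl m M T ⟩
  (m * M) * (m * M) + m * m * (T * m)
    ≡⟨ cong (λ s → (m * M) * (m * M) + m * m * s) (totalOverlap-power m k) ⟩
  (m * M) * (m * M) + m * m * (k * (M * M))
    ≡⟨ solve 3 (λ m M k → (m :* M) :* (m :* M) :+ m :* m :* (k :* (M :* M)) := (con 1 :+ k) :* ((m :* M) :* (m :* M))) refl m M k ⟩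
  suc k * (m * M * (m * M)) ∎
  where
  open ≡-Reasoning
  M : ℕ
  M = m ^ k
  T : ℕ
  T = totalOverlap (power m k)

IsZeroRectangle : ∀ {n d} → (Fin n → Subset d) → Subset n → Subset n → Set
IsZeroRectangle F R S = ∀ i j → i ∈ R → j ∈ S → ∣ F i ∩ F j ∣ ≡ 0

module _ {p q : ℕ} where

  slice : Subset (p * q) → Fin p → Subset q
  slice R x = Vec.tabulate (λ y → lookup R (combine x y))

  ∈-slice : ∀ (R : Subset (p * q)) x {y} → y ∈ slice R x → combine x y ∈ R
  ∈-slice R x {y} y∈Rx =
    lookup⇒[]= (combine x y) R (trans (sym (lookup∘tabulate _ y)) ([]=⇒lookup y∈Rx))

  ∣R∣≡∑∣slice∣ : ∀ (R : Subset (p * q)) → ∣ R ∣ ≡ ∑[ x < p ] ∣ slice R x ∣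
  ∣R∣≡∑∣slice∣ R = begin
    ∣ R ∣
      ≡⟨ ∣p∣≡∑indicator R ⟩
    ∑[ i < p * q ] indicator (lookup R i)
      ≡⟨ ∑-combine p q _ ⟩
    ∑[ x < p ] ∑[ y < q ] indicator (lookup R (combine x y))
      ≡⟨ sum-cong-≗ {p} (λ x → sum-cong-≗ {q} (cong indicator ∘ lookup∘tabulate (lookup R ∘ combine x))) ⟨
    ∑[ x < p ] ∑[ y < q ] indicator (lookup (slice R x) y)
      ≡⟨ sum-cong-≗ (∣p∣≡∑indicator ∘ slice R) ⟨
    ∑[ x < p ] ∣ slice R x ∣ ∎
    where open ≡-Reasoning

  nonemptySlices : Subset (p * q) → ℕ
  nonemptySlices R = ∑[ x < p ] signum ∣ slice R x ∣

  rectangle≤nonemptySlices : ∀ c (R S : Subset (p * q)) →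
    (∀ x y → c * (∣ slice R x ∣ * ∣ slice S y ∣) ≤ q * q) →
    c * (∣ R ∣ * ∣ S ∣) ≤ q * q * (nonemptySlices R * nonemptySlices S)
  rectangle≤nonemptySlices c R S slice-bound = begin
    c * (∣ R ∣ * ∣ S ∣)
      ≡⟨ cong (c *_) (cong₂ _*_ (∣R∣≡∑∣slice∣ R) (∣R∣≡∑∣slice∣ S)) ⟩
    c * (sum r * sum s)
      ≡⟨ ∑-*-∑ c r s ⟩
    ∑[ x < p ] ∑[ y < p ] (c * (r x * s y))
      ≤⟨ ∑-mono-≤ (λ x → ∑-mono-≤ (λ y → *≤⇒*≤*signum c (r x) (s y) (q * q) (slice-bound x y))) ⟩
    ∑[ x < p ] ∑[ y < p ] (q * q * (signum (r x) * signum (s y)))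
      ≡⟨ ∑-*-∑ (q * q) (signum ∘ r) (signum ∘ s) ⟨
    q * q * (nonemptySlices R * nonemptySlices S) ∎
    where
    open ≤-Reasoning
    r : Fin p → ℕ
    r = ∣_∣ ∘ slice R
    s : Fin p → ℕ
    s = ∣_∣ ∘ slice S

slice-isZeroRectangle : ∀ {p q a b} (F : Fin p → Subset a) (G : Fin q → Subset b) {R S} →
                        IsZeroRectangle (F ⊗ G) R S → ∀ x x′ → IsZeroRectangle G (slice R x) (slice S x′)
slice-isZeroRectangle F G {R} {S} R×S≡0 x x′ y y′ y∈Rx y′∈Sx′ =
  m+n≡0⇒n≡0 ∣ F x ∩ F x′ ∣ (trans (sym (∣⊗∩⊗∣ F G x y x′ y′)) (R×S≡0 _ _ (∈-slice R x y∈Rx) (∈-slice S x′ y′∈Sx′)))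

slice-diagonal : ∀ {p q a b} (F : Fin p → Subset a) (G : Fin q → Subset b) {R S} →
                 IsZeroRectangle (F ⊗ G) R S → ∀ x → ∣ F x ∣ ≢ 0 →
                 Nonempty (slice R x) → Empty (slice S x)
slice-diagonal F G {R} {S} R×S≡0 x ∣Fx∣≢0 (y , y∈Rx) (y′ , y′∈Sx) = ∣Fx∣≢0 (begin
  ∣ F x ∣        ≡⟨ cong ∣_∣ (∩-idem (F x)) ⟨
  ∣ F x ∩ F x ∣  ≡⟨ m+n≡0⇒m≡0 _ (trans (sym (∣⊗∩⊗∣ F G x y x y′)) (R×S≡0 _ _ (∈-slice R x y∈Rx) (∈-slice S x y′∈Sx))) ⟩
  0              ∎)
  where open ≡-Reasoning

nonemptySlices-+≤ : ∀ {p q a b} (F : Fin p → Subset a) (G : Fin q → Subset b) {R S} →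
                    (∀ x → ∣ F x ∣ ≢ 0) → IsZeroRectangle (F ⊗ G) R S →
                    nonemptySlices {p} {q} R + nonemptySlices {p} {q} S ≤ p
nonemptySlices-+≤ {p} {q} F G {R} {S} F≢∅ R×S≡0 = begin
  nonemptySlices {p} {q} R + nonemptySlices {p} {q} S
    ≡⟨ ∑-distrib-+ (signum ∘ ∣_∣ ∘ slice {p} R) (signum ∘ ∣_∣ ∘ slice {p} S) ⟨
  ∑[ x < p ] (signum ∣ slice R x ∣ + signum ∣ slice S x ∣)
    ≤⟨ ∑-mono-≤ (λ x → signum+signum≤1 _ _ (λ (Rx≢∅ , Sx≢∅) →
         slice-diagonal F G R×S≡0 x (F≢∅ x) (∣p∣≢0⇒Nonempty _ Rx≢∅) (∣p∣≢0⇒Nonempty _ Sx≢∅))) ⟩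
  ∑[ x < p ] 1
    ≡⟨ trans (∑-const p 1) (*-identityʳ p) ⟩
  p ∎
  where open ≤-Reasoning

isZeroRectangle-⊗ : ∀ {p q a b} (F : Fin p → Subset a) (G : Fin q → Subset b) c →
  (∀ x → ∣ F x ∣ ≢ 0) →
  (∀ R S → IsZeroRectangle G R S → c * (∣ R ∣ * ∣ S ∣) ≤ q * q) →
  ∀ R S → IsZeroRectangle (F ⊗ G) R S → 4 * c * (∣ R ∣ * ∣ S ∣) ≤ p * q * (p * q)
isZeroRectangle-⊗ {p} {q} F G c F≢∅ G-bound R S R×S≡0 = begin
  4 * c * (∣ R ∣ * ∣ S ∣)
    ≡⟨ *-assoc 4 c _ ⟩
  4 * (c * (∣ R ∣ * ∣ S ∣))
    ≤⟨ *-monoʳ-≤ 4 (rectangle≤nonemptySlices c R S (λ x y → G-bound _ _ (slice-isZeroRectangle F G R×S≡0 x y))) ⟩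
  4 * (q * q * (A * B))
    ≡⟨ solve 3 (λ q A B → con 4 :* (q :* q :* (A :* B)) := q :* q :* (con 4 :* (A :* B))) refl q A B ⟩
  q * q * (4 * (A * B))
    ≤⟨ *-monoʳ-≤ (q * q) (≤-trans (4*m*n≤[m+n]² A B) (*-mono-≤ A+B≤p A+B≤p)) ⟩
  q * q * (p * p)
    ≡⟨ solve 2 (λ p q → q :* q :* (p :* p) := p :* q :* (p :* q)) refl p q ⟩
  p * q * (p * q) ∎
  where
  open ≤-Reasoning
  A : ℕ
  A = nonemptySlices {p} {q} R
  B : ℕ
  B = nonemptySlices {p} {q} S
  A+B≤p : A + B ≤ p
  A+B≤p = nonemptySlices-+≤ F G F≢∅ R×S≡0

isZeroRectangle-power : ∀ m k R S → IsZeroRectangle (power m k) R S →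
                        4 ^ k * (∣ R ∣ * ∣ S ∣) ≤ m ^ k * m ^ k
isZeroRectangle-power m zero    R S _ =
  ≤-trans (≤-reflexive (*-identityˡ _)) (*-mono-≤ (∣p∣≤n R) (∣p∣≤n S))
isZeroRectangle-power m (suc k) =
  isZeroRectangle-⊗ (⁅_⁆ {m}) (power m k) (4 ^ k) ⁅x⁆≢∅ (isZeroRectangle-power m k)
  where
  ⁅x⁆≢∅ : ∀ (x : Fin m) → ∣ ⁅ x ⁆ ∣ ≢ 0
  ⁅x⁆≢∅ x ∣⁅x⁆∣≡0 = contradiction (trans (sym (∣⁅x⁆∣≡1 x)) ∣⁅x⁆∣≡0) (λ ())

powerSystem : ∀ m k .{{_ : NonZero m}} → SetSystem (k * m)
powerSystem m k = setSystem (m ^ k) (m^n>0 m k) (power m k) (power-injective m k)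

intersectingPairs≤∑Mat : ∀ {d} (𝒜 ℬ : SetSystem d) →
                         intersectingPairs 𝒜 ℬ ≤ ∑[ i < size 𝒜 ] ∑[ j < size ℬ ] Mat 𝒜 ℬ i j
intersectingPairs≤∑Mat 𝒜 ℬ = begin
  intersectingPairs 𝒜 ℬ
    ≡⟨ trans (sum-map-allFin (size 𝒜) _) (sum-cong-≗ {size 𝒜} (λ i → sum-map-allFin (size ℬ) _)) ⟩
  ∑[ i < size 𝒜 ] ∑[ j < size ℬ ] (if Mat 𝒜 ℬ i j ≡ᵇ 0 then 0 else 1)
    ≤⟨ ∑-mono-≤ (λ i → ∑-mono-≤ (λ j → [n≢0]≤n (Mat 𝒜 ℬ i j))) ⟩
  ∑[ i < size 𝒜 ] ∑[ j < size ℬ ] Mat 𝒜 ℬ i j ∎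
  where
  open ≤-Reasoning
  [n≢0]≤n : ∀ n → (if n ≡ᵇ 0 then 0 else 1) ≤ n
  [n≢0]≤n zero    = z≤n
  [n≢0]≤n (suc n) = s≤s z≤n

^-distrib-* : ∀ m n o → (m * n) ^ o ≡ m ^ o * n ^ o
^-distrib-* m n zero    = refl
^-distrib-* m n (suc o) = begin
  m * n * (m * n) ^ o      ≡⟨ cong (m * n *_) (^-distrib-* m n o) ⟩
  m * n * (m ^ o * n ^ o)  ≡⟨ solve 4 (λ m n x y → m :* n :* (x :* y) := m :* x :* (n :* y)) refl m n (m ^ o) (n ^ o) ⟩
  m * m ^ o * (n * n ^ o)  ∎
  where open ≡-Reasoning

p<c√dq⇒p≤kq : ∀ {a b d} k p q → a * a * d ≤ k * k * (b * b) →
              p * p * (b * b) < a * a * d * (q * q) → p ≤ k * q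
p<c√dq⇒p≤kq {a} {b} {d} k p q c²d≤k² p²b²<c²dq² with p ≤? k * q
... | yes p≤kq = p≤kq
... | no  p≰kq = contradiction p²b²<c²dq² (≤⇒≯ (begin
  a * a * d * (q * q)        ≤⟨ *-monoˡ-≤ (q * q) c²d≤k² ⟩
  k * k * (b * b) * (q * q)  ≡⟨ solve 3 (λ k b q → k :* k :* (b :* b) :* (q :* q) := k :* q :* (k :* q) :* (b :* b)) refl k b q ⟩
  k * q * (k * q) * (b * b)  ≤⟨ *-monoˡ-≤ (b * b) (*-mono-≤ kq≤p kq≤p) ⟩
  p * p * (b * b)            ∎))
  where
  open ≤-Reasoning
  kq≤p : k * q ≤ p
  kq≤p = <⇒≤ (≰⇒> p≰kq)

2^k*r≤N⇒DensityAtMostExp : ∀ {r N a b d} k → a * a * d ≤ k * k * (b * b) → 2 ^ k * r ≤ N →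
                           DensityAtMostExp r N a b d
2^k*r≤N⇒DensityAtMostExp {r} {N} {a} {b} {d} k c²d≤k² 2^kr≤N p q _ p²b²<c²dq² = begin
  2 ^ p * r ^ q          ≤⟨ *-monoˡ-≤ (r ^ q) (^-monoʳ-≤ 2 (p<c√dq⇒p≤kq {a} {b} {d} k p q c²d≤k² p²b²<c²dq²)) ⟩
  2 ^ (k * q) * r ^ q    ≡⟨ cong (_* r ^ q) (^-*-assoc 2 k q) ⟨
  (2 ^ k) ^ q * r ^ q    ≡⟨ ^-distrib-* (2 ^ k) r q ⟨
  (2 ^ k * r) ^ q        ≤⟨ ^-monoˡ-≤ q 2^kr≤N ⟩
  N ^ q                  ∎
  where open ≤-Reasoning

-- (+ I) / n is the normalisation of the unnormalised fraction I/n, so the claim is the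
-- cross-multiplied inequality I · ↧ δ ≤ ↥ δ · n, which holds as ↥ δ ≥ 1.
*↧≤⇒/≤ : ∀ (δ : ℚ) → 0ℚ ℚ.< δ → ∀ I n .{{_ : NonZero n}} → I * ℚ.↧ₙ δ ≤ n → (ℤ.+ I) ℚ./ n ℚ.≤ δ
*↧≤⇒/≤ (ℚ.mkℚ (ℤ.+ zero)  _ _) (ℚ.*<* (ℤ.+<+ ())) I n I↧δ≤n
*↧≤⇒/≤ (ℚ.mkℚ ℤ.-[1+ _ ]  _ _) (ℚ.*<* ())          I n I↧δ≤n
*↧≤⇒/≤ (ℚ.mkℚ ℤ.+[1+ u ] d-1 _) _ I n@(suc n-1) I↧δ≤n =
  ℚP.toℚᵘ-cancel-≤ (ℚᵘP.≤-respˡ-≃ (ℚᵘP.≃-sym (ℚP.toℚᵘ-fromℚᵘ (ℚᵘ.mkℚᵘ (ℤ.+ I) n-1)))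
    (ℚᵘ.*≤* (subst₂ ℤ._≤_ (ℤP.pos-* I (suc d-1)) (ℤP.pos-* (suc u) n)
      (ℤ.+≤+ (≤-trans I↧δ≤n (m≤n*m n (suc u)))))))

blockSystem : ∀ t k .{{_ : NonZero t}} .{{_ : NonZero k}} → SetSystem (k * (t * k))
blockSystem t k = powerSystem (t * k) k {{m*n≢0 t k}}

blockSystem-almostCrossDisjoint : ∀ δ → 0ℚ ℚ.< δ → ∀ k .{{_ : NonZero k}} →
  AlmostCrossDisjoint δ (blockSystem (ℚ.↧ₙ δ) k) (blockSystem (ℚ.↧ₙ δ) k)
blockSystem-almostCrossDisjoint δ 0<δ k =
  *↧≤⇒/≤ δ 0<δ I (M * M) {{m*n≢0 M M}} (*-cancelʳ-≤ (I * t) (M * M) k (begin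
    I * t * k                       ≡⟨ *-assoc I t k ⟩
    I * m                           ≤⟨ *-monoˡ-≤ m (intersectingPairs≤∑Mat 𝒜 𝒜) ⟩
    totalOverlap (power m k) * m    ≡⟨ totalOverlap-power m k ⟩
    k * (M * M)                     ≡⟨ *-comm k (M * M) ⟩
    M * M * k                       ∎))
  where
  open ≤-Reasoning
  t : ℕ
  t = ℚ.↧ₙ δ
  m : ℕ
  m = t * k
  instance
    m≢0 : NonZero m
    m≢0 = m*n≢0 t k
  M : ℕ
  M = m ^ k
  instance
    M≢0 : NonZero M
    M≢0 = m^n≢0 m k
  𝒜 : SetSystem (k * m)
  𝒜 = blockSystem t k
  I : ℕ
  I = intersectingPairs 𝒜 𝒜

blockSystem-density : ∀ t k .{{_ : NonZero t}} .{{_ : NonZero k}} R S →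
  ZeroMonochromatic (blockSystem t k) (blockSystem t k) R S →
  DensityAtMostExp (∣ R ∣ * ∣ S ∣) (size (blockSystem t k) * size (blockSystem t k)) 1 t (k * (t * k))
blockSystem-density t k R S R×S≡0 =
  2^k*r≤N⇒DensityAtMostExp {a = 1} {t} {k * (t * k)} k d≤k²t² (begin
    2 ^ k * (∣ R ∣ * ∣ S ∣)   ≤⟨ *-monoˡ-≤ _ (^-monoˡ-≤ k (s≤s (s≤s z≤n))) ⟩
    4 ^ k * (∣ R ∣ * ∣ S ∣)   ≤⟨ isZeroRectangle-power (t * k) k R S R×S≡0 ⟩
    (t * k) ^ k * (t * k) ^ k ∎)
  where
  open ≤-Reasoning
  d≤k²t² : 1 * 1 * (k * (t * k)) ≤ k * k * (t * t)
  d≤k²t² = begin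
    1 * 1 * (k * (t * k))     ≡⟨ solve 2 (λ k t → con 1 :* con 1 :* (k :* (t :* k)) := k :* k :* (t :* con 1)) refl k t ⟩
    k * k * (t * 1)           ≤⟨ *-monoʳ-≤ (k * k) (*-monoʳ-≤ t (>-nonZero⁻¹ t)) ⟩
    k * k * (t * t)           ∎

theorem5p2 : (a b : ℚ) → 0ℚ ℚ.≤ a → a ℚ.< b → b ℚ.≤ 1ℚ →
  Σ (ℕ → ℕ) λ d →
  Σ ((i : ℕ) → SetSystem (d i) × SetSystem (d i)) λ 𝒜ℬ →
  Σ (ℕ → ℚ) λ δ →
  Σ ℕ λ ca → Σ ℕ λ cb →
    (0 < d 0) × ((i : ℕ) → d i < d (suc i))
    × ((η : ℚ) → 0ℚ ℚ.< η → Σ ℕ λ N → (i j : ℕ) → N ≤ i → N ≤ j →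
         ℚ.∣ δ i - δ j ∣ ℚ.< η)
    × Σ ℚ (λ a′ → Σ ℚ λ b′ → a ℚ.< a′ × b′ ℚ.< b ×
         Σ ℕ λ N → (i : ℕ) → N ≤ i → a′ ℚ.≤ δ i × δ i ℚ.≤ b′)
    × 0 < ca × 0 < cb
    × ((i : ℕ) → AlmostCrossDisjoint (δ i) (proj₁ (𝒜ℬ i)) (proj₂ (𝒜ℬ i)))
    × ((i : ℕ) → ∀ ℛ 𝒮 → ZeroMonochromatic (proj₁ (𝒜ℬ i)) (proj₂ (𝒜ℬ i)) ℛ 𝒮 →
         DensityAtMostExp (∣ ℛ ∣ * ∣ 𝒮 ∣)
           (size (proj₁ (𝒜ℬ i)) * size (proj₂ (𝒜ℬ i))) ca cb (d i))

theorem5p2 a b 0≤a a<b _ =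
    d , (λ i → 𝒜 i , 𝒜 i) , (λ _ → δ) , 1 , t
  , s≤s z≤n , d-increasing , constant-cauchy
  , (δ , δ , a<δ , δ<b , 0 , λ _ _ → ℚP.≤-refl , ℚP.≤-refl)
  , s≤s z≤n , s≤s z≤n
  , (λ i → blockSystem-almostCrossDisjoint δ 0<δ (suc i))
  , (λ i → blockSystem-density t (suc i))
  where
  δ : ℚ
  δ = proj₁ (ℚP.<-dense a<b)
  a<δ : a ℚ.< δ
  a<δ = proj₁ (proj₂ (ℚP.<-dense a<b))
  δ<b : δ ℚ.< b
  δ<b = proj₂ (proj₂ (ℚP.<-dense a<b))
  0<δ : 0ℚ ℚ.< δ
  0<δ = ℚP.≤-<-trans 0≤a a<δ
  t : ℕ
  t = ℚ.↧ₙ δ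
  d : ℕ → ℕ
  d i = suc i * (t * suc i)
  𝒜 : (i : ℕ) → SetSystem (d i)
  𝒜 i = blockSystem t (suc i)
  d-increasing : ∀ i → d i < d (suc i)
  d-increasing i = *-mono-< (n<1+n (suc i)) (*-monoʳ-< t (n<1+n (suc i)))
  constant-cauchy : ∀ η → 0ℚ ℚ.< η → Σ ℕ λ N → ∀ i j → N ≤ i → N ≤ j → ℚ.∣ δ - δ ∣ ℚ.< η
  constant-cauchy η 0<η = 0 , λ _ _ _ _ → subst (ℚ._< η) (sym (cong ℚ.∣_∣ (ℚP.+-inverseʳ δ))) 0<η
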